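{- Let $s,t$ be positive integers and let $M$ be an $(s,t)$-spike of order $m$. Then $r(M)=m+s-t$ and $r^*(M)=m-s+t$.
   Context: For positive integers $s,t$, an $(s,t)$-spike of order $m$ is a matroid $M$ with $m\ge\max\{s,t\}$ together with an associated partition $(A_1,\dots,A_m)$ of $E(M)$ into $2$-element sets (arms) such that the union of any $s$ arms is a circuit of $M$ and the union of any $t$ arms is a cocircuit of $M$. $r^*$ denotes the rank function of $M^*$. -}

module Defs where

open import Data.Nat using (ℕ; _≤_; _<_)
open import Data.Fin using (Fin; _≟_)
open import Data.Fin.Subset using (Subset; ⊥; _∪_; ⁅_⁆; _∈_; _∉_; _⊆_; _⊂_; ∁; ∣_∣)
open import Data.Vec using (tabulate; lookup)
open import Data.Product using (Σ; _×_)
open import Relation.Nullary using (¬_)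
open import Relation.Binary.PropositionalEquality using (_≡_)

record Matroid (n : ℕ) : Set₁ where
  field
    Indep   : Subset n → Set
    indep-∅ : Indep ⊥
    indep-↓ : ∀ I J → J ⊆ I → Indep I → Indep J
    indep-aug : ∀ I J → Indep I → Indep J → ∣ I ∣ < ∣ J ∣ →
                Σ (Fin n) (λ e → e ∈ J × e ∉ I × Indep (I ∪ ⁅ e ⁆))
open Matroid public

module _ {n : ℕ} where

  HasRank : (Subset n → Set) → ℕ → Set
  HasRank P k = Σ (Subset n) (λ I → P I × ∣ I ∣ ≡ k) × (∀ I → P I → ∣ I ∣ ≤ k)

  IsCircuitOf : (Subset n → Set) → Subset n → Set
  IsCircuitOf P C = ¬ P C × (∀ X → X ⊂ C → P X)

  IsBasis : Matroid n → Subset n → Set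
  IsBasis M B = Indep M B × (∀ X → B ⊂ X → ¬ Indep M X)

  -- independent sets of the dual matroid M*: sets avoiding some basis of M
  CoIndep : Matroid n → Subset n → Set
  CoIndep M I = Σ (Subset n) (λ B → IsBasis M B × I ⊆ ∁ B)

  RankIs : Matroid n → ℕ → Set
  RankIs M k = HasRank (Indep M) k

  CoRankIs : Matroid n → ℕ → Set
  CoRankIs M k = HasRank (CoIndep M) k

  IsCircuit : Matroid n → Subset n → Set
  IsCircuit M = IsCircuitOf (Indep M)

  IsCocircuit : Matroid n → Subset n → Set
  IsCocircuit M = IsCircuitOf (CoIndep M)

-- Arms: `arm : Fin n → Fin m` assigns each element to the arm containing it;
-- this encodes a partition (A_1,...,A_m) of E(M) = Fin n with A_i = arm⁻¹(i).
armUnion : {n m : ℕ} → (Fin n → Fin m) → Subset m → Subset n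
armUnion arm S = tabulate (λ e → lookup S (arm e))

armSet : {n m : ℕ} → (Fin n → Fin m) → Fin m → Subset n
armSet arm i = armUnion arm ⁅ i ⁆

record IsSpike {n : ℕ} (M : Matroid n) (s t m : ℕ) (arm : Fin n → Fin m) : Set where
  field
    s≤m : s ≤ m
    t≤m : t ≤ m
    arms-size2 : ∀ i → ∣ armSet arm i ∣ ≡ 2
    s-circuit : ∀ (S : Subset m) → ∣ S ∣ ≡ s → IsCircuit M (armUnion arm S)
    t-cocircuit : ∀ (T : Subset m) → ∣ T ∣ ≡ t → IsCocircuit M (armUnion arm T)

-- A hereditary family P of sets (the independent or the coindependent sets of M)
-- that contains no union of s arms has no member X inside the arms indexed by K
-- with |X| ≥ |K| + s: X meets each arm of K in at most one element, except for
-- the fewer than s arms it contains entirely.  Deleting an element e from the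
-- union D of t arms, a cocircuit, leaves a coindependent set, so some basis B
-- avoids D − e; then B − e is independent and lies in the other m − t arms,
-- whence r(M) = |B| ≤ m − t + s.  Dually, a circuit C of s arms minus one
-- element extends to a basis B′, and ∁B′ − e is coindependent inside the other
-- m − s arms, so r*(M) = n − |B′| ≤ m − s + t.  Since n = 2m is the sum of
-- the two bounds, both are equalities.

module Submission where

open import Defs
open import Data.Nat using (ℕ; _≤_; _∸_)
open import Data.Fin using (Fin)
open import Data.Fin.Subset using (∣_∣)
open import Data.Product using (Σ; _×_; _,_)
open import Relation.Binary.PropositionalEquality using (_≡_; trans; cong)

-- A separate module, so that ℕ's _+_ is not in scope next to ℤ's in lemma5p2.
module SpikeRank where

  open import Data.Bool using (Bool; true; false; _∧_)
  open import Data.Empty using (⊥-elim)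
  open import Data.Fin using (zero; suc)
  open import Data.Fin.Subset
    using (Subset; Nonempty; ⊥; ⊤; _∪_; _∩_; _─_; _-_; ⁅_⁆; _∈_; _∉_; _⊆_; ∁)
  open import Data.Fin.Subset.Properties
  open import Data.Nat using (zero; suc; _+_; _*_; _<_; z≤n; s≤s; _≤?_)
  open import Data.Nat.Properties
  open import Algebra.Properties.CommutativeMonoid.Sum +-0-commutativeMonoid
    using (sum; sum-syntax; ∑-distrib-+; sum-cong-≗)
  open import Data.Vec using ([]; _∷_; lookup; tabulate; here; there)
  open import Data.Vec.Properties using (lookup∘tabulate; lookup-replicate; []=⇒lookup; lookup⇒[]=)
  open import Data.Product using (proj₁; proj₂)
  open import Function using (_∘_)
  import Data.Integer as ℤ
  import Data.Integer.Properties as ℤ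
  open import Data.Integer.Tactic.RingSolver using () renaming (solve-∀ to solve-∀-ℤ)
  open import Data.Nat.Tactic.RingSolver using (solve-∀)
  open import Relation.Nullary using (¬_; yes; no; does; contradiction)
  open import Relation.Binary.PropositionalEquality using (refl; sym; cong₂; subst; module ≡-Reasoning)

  private variable
    n m : ℕ

  𝟙 : Bool → ℕ
  𝟙 true  = 1
  𝟙 false = 0

  ∣b∷p∣≡𝟙b+∣p∣ : ∀ b (p : Subset n) → ∣ b ∷ p ∣ ≡ 𝟙 b + ∣ p ∣
  ∣b∷p∣≡𝟙b+∣p∣ true  p = refl
  ∣b∷p∣≡𝟙b+∣p∣ false p = refl

  ∣p∣≤1+∣p-x∣ : ∀ (p : Subset n) x → ∣ p ∣ ≤ suc ∣ p - x ∣
  ∣p∣≤1+∣p-x∣ (true  ∷ p) zero    = s≤s (≤-reflexive (cong ∣_∣ (sym (p─⊥≡p p))))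
  ∣p∣≤1+∣p-x∣ (false ∷ p) zero    = m≤n⇒m≤1+n (≤-reflexive (cong ∣_∣ (sym (p─⊥≡p p))))
  ∣p∣≤1+∣p-x∣ (true  ∷ p) (suc x) = s≤s (∣p∣≤1+∣p-x∣ p x)
  ∣p∣≤1+∣p-x∣ (false ∷ p) (suc x) = ∣p∣≤1+∣p-x∣ p x

  x∈p─q⇒x∉q : ∀ (p q : Subset n) {x} → x ∈ p ─ q → x ∉ q
  x∈p─q⇒x∉q (_ ∷ p) (true ∷ q) () here
  x∈p─q⇒x∉q (_ ∷ p) (_ ∷ q) (there x∈p─q) (there x∈q) = x∈p─q⇒x∉q p q x∈p─q x∈q

  x∉p⇒∣p∪⁅x⁆∣≡1+∣p∣ : ∀ (p : Subset n) x → x ∉ p → ∣ p ∪ ⁅ x ⁆ ∣ ≡ suc ∣ p ∣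
  x∉p⇒∣p∪⁅x⁆∣≡1+∣p∣ (true  ∷ p) zero    x∉p = contradiction here x∉p
  x∉p⇒∣p∪⁅x⁆∣≡1+∣p∣ (false ∷ p) zero    x∉p = cong (suc ∘ ∣_∣) (∪-identityʳ p)
  x∉p⇒∣p∪⁅x⁆∣≡1+∣p∣ (true  ∷ p) (suc x) x∉p = cong suc (x∉p⇒∣p∪⁅x⁆∣≡1+∣p∣ p x (x∉p ∘ there))
  x∉p⇒∣p∪⁅x⁆∣≡1+∣p∣ (false ∷ p) (suc x) x∉p = x∉p⇒∣p∪⁅x⁆∣≡1+∣p∣ p x (x∉p ∘ there)

  p⊆q∧∣q∣≤∣p∣⇒q⊆p : ∀ (p q : Subset n) → p ⊆ q → ∣ q ∣ ≤ ∣ p ∣ → q ⊆ p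
  p⊆q∧∣q∣≤∣p∣⇒q⊆p [] [] _ _ ()
  p⊆q∧∣q∣≤∣p∣⇒q⊆p (false ∷ p) (false ∷ q) p⊆q ∣q∣≤∣p∣ =
    out⊆ (p⊆q∧∣q∣≤∣p∣⇒q⊆p p q (drop-∷-⊆ p⊆q) ∣q∣≤∣p∣)
  p⊆q∧∣q∣≤∣p∣⇒q⊆p (false ∷ p) (true  ∷ q) p⊆q ∣q∣≤∣p∣ =
    contradiction ∣q∣≤∣p∣ (<⇒≱ (s≤s (p⊆q⇒∣p∣≤∣q∣ (drop-∷-⊆ p⊆q))))
  p⊆q∧∣q∣≤∣p∣⇒q⊆p (true  ∷ p) (false ∷ q) p⊆q _ with () ← p⊆q here
  p⊆q∧∣q∣≤∣p∣⇒q⊆p (true  ∷ p) (true  ∷ q) p⊆q ∣q∣≤∣p∣ =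
    in⊆in (p⊆q∧∣q∣≤∣p∣⇒q⊆p p q (drop-∷-⊆ p⊆q) (≤-pred ∣q∣≤∣p∣))

  p⊆q∧q⊈p⇒∣p∣<∣q∣ : ∀ {p q : Subset n} → p ⊆ q → ¬ (q ⊆ p) → ∣ p ∣ < ∣ q ∣
  p⊆q∧q⊈p⇒∣p∣<∣q∣ {p = p} {q} p⊆q q⊈p with ∣ q ∣ ≤? ∣ p ∣
  ... | yes ∣q∣≤∣p∣ = ⊥-elim (q⊈p (p⊆q∧∣q∣≤∣p∣⇒q⊆p p q p⊆q ∣q∣≤∣p∣))
  ... | no  ∣q∣≰∣p∣ = ≰⇒> ∣q∣≰∣p∣

  ⊆-ofSize : ∀ (p : Subset n) k → k ≤ ∣ p ∣ → Σ (Subset n) (λ q → q ⊆ p × ∣ q ∣ ≡ k)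
  ⊆-ofSize {n} p zero _ = ⊥ , ⊥⊆ , ∣⊥∣≡0 n
  ⊆-ofSize (true ∷ p) (suc k) k<∣p∣ with ⊆-ofSize p k (≤-pred k<∣p∣)
  ... | q , q⊆p , ∣q∣≡k = true ∷ q , in⊆in q⊆p , cong suc ∣q∣≡k
  ⊆-ofSize (false ∷ p) (suc k) k<∣p∣ with ⊆-ofSize p (suc k) k<∣p∣
  ... | q , q⊆p , ∣q∣≡k = false ∷ q , out⊆ q⊆p , ∣q∣≡k

  1≤∣p∣⇒Nonempty : ∀ (p : Subset n) → 1 ≤ ∣ p ∣ → Nonempty p
  1≤∣p∣⇒Nonempty (true  ∷ p) _ = zero , here
  1≤∣p∣⇒Nonempty (false ∷ p) 1≤∣p∣ with 1≤∣p∣⇒Nonempty p 1≤∣p∣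
  ... | x , x∈p = suc x , there x∈p

  p─r⊆∁q⇒q─r⊆∁p : ∀ {p q r : Subset n} → p ─ r ⊆ ∁ q → q ─ r ⊆ ∁ p
  p─r⊆∁q⇒q─r⊆∁p {p = p} {q} {r} p─r⊆∁q x∈q─r = x∉p⇒x∈∁p λ x∈p →
    x∈∁p⇒x∉p (p─r⊆∁q (x∈p∧x∉q⇒x∈p─q x∈p (x∈p─q⇒x∉q q r x∈q─r))) (p─q⊆p q r x∈q─r)

  ∑-mono-≤ : ∀ {f g : Fin m → ℕ} → (∀ i → f i ≤ g i) → sum f ≤ sum g
  ∑-mono-≤ {zero}  _   = z≤n
  ∑-mono-≤ {suc m} f≤g = +-mono-≤ (f≤g zero) (∑-mono-≤ (f≤g ∘ suc))

  ∑-const : ∀ m k → ∑[ i < m ] k ≡ m * k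
  ∑-const zero    k = refl
  ∑-const (suc m) k = cong (k +_) (∑-const m k)

  ∑-𝟙-lookup : ∀ (p : Subset m) → ∑[ i < m ] 𝟙 (lookup p i) ≡ ∣ p ∣
  ∑-𝟙-lookup []      = refl
  ∑-𝟙-lookup (b ∷ p) = trans (cong (𝟙 b +_) (∑-𝟙-lookup p)) (sym (∣b∷p∣≡𝟙b+∣p∣ b p))

  lookup-⁅⁆-sym : ∀ (i j : Fin m) → lookup ⁅ i ⁆ j ≡ lookup ⁅ j ⁆ i
  lookup-⁅⁆-sym zero    zero    = refl
  lookup-⁅⁆-sym zero    (suc j) = lookup-replicate j false
  lookup-⁅⁆-sym (suc i) zero    = sym (lookup-replicate i false)
  lookup-⁅⁆-sym (suc i) (suc j) = lookup-⁅⁆-sym i j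

  ∑-𝟙-∧-⁅⁆ : ∀ b (x : Fin m) → ∑[ i < m ] 𝟙 (b ∧ lookup ⁅ i ⁆ x) ≡ 𝟙 b
  ∑-𝟙-∧-⁅⁆ {m} false x = trans (∑-const m 0) (*-zeroʳ m)
  ∑-𝟙-∧-⁅⁆ {m} true  x = begin
    ∑[ i < m ] 𝟙 (lookup ⁅ i ⁆ x) ≡⟨ sum-cong-≗ (λ i → cong 𝟙 (lookup-⁅⁆-sym i x)) ⟩
    ∑[ i < m ] 𝟙 (lookup ⁅ x ⁆ i) ≡⟨ ∑-𝟙-lookup ⁅ x ⁆ ⟩
    ∣ ⁅ x ⁆ ∣                     ≡⟨ ∣⁅x⁆∣≡1 x ⟩
    1                             ∎
    where open ≡-Reasoning

  ∑∣X∩armSet∣≡∣X∣ : ∀ (f : Fin n → Fin m) (X : Subset n) → ∑[ i < m ] ∣ X ∩ armSet f i ∣ ≡ ∣ X ∣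
  ∑∣X∩armSet∣≡∣X∣ {zero} {m} f [] = trans (∑-const m 0) (*-zeroʳ m)
  ∑∣X∩armSet∣≡∣X∣ {suc n} {m} f (b ∷ X) = begin
    ∑[ i < m ] ∣ (b ∧ lookup ⁅ i ⁆ (f zero)) ∷ X ∩ armSet (f ∘ suc) i ∣
      ≡⟨ sum-cong-≗ (λ i → ∣b∷p∣≡𝟙b+∣p∣ (b ∧ lookup ⁅ i ⁆ (f zero)) (X ∩ armSet (f ∘ suc) i)) ⟩
    ∑[ i < m ] (𝟙 (b ∧ lookup ⁅ i ⁆ (f zero)) + ∣ X ∩ armSet (f ∘ suc) i ∣)
      ≡⟨ ∑-distrib-+ (λ i → 𝟙 (b ∧ lookup ⁅ i ⁆ (f zero))) (λ i → ∣ X ∩ armSet (f ∘ suc) i ∣) ⟩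
    ∑[ i < m ] 𝟙 (b ∧ lookup ⁅ i ⁆ (f zero)) + ∑[ i < m ] ∣ X ∩ armSet (f ∘ suc) i ∣
      ≡⟨ cong₂ _+_ (∑-𝟙-∧-⁅⁆ b (f zero)) (∑∣X∩armSet∣≡∣X∣ (f ∘ suc) X) ⟩
    𝟙 b + ∣ X ∣
      ≡⟨ ∣b∷p∣≡𝟙b+∣p∣ b X ⟨
    ∣ b ∷ X ∣ ∎
    where open ≡-Reasoning

  Hereditary : (Subset n → Set) → Set
  Hereditary {n} P = ∀ (I J : Subset n) → J ⊆ I → P I → P J

  module _ (M : Matroid n) where

    basis-maximum : ∀ {B I} → IsBasis M B → Indep M I → ∣ I ∣ ≤ ∣ B ∣
    basis-maximum {B} {I} (indB , maxB) indI with ∣ I ∣ ≤? ∣ B ∣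
    ... | yes ∣I∣≤∣B∣ = ∣I∣≤∣B∣
    ... | no  ∣I∣≰∣B∣ with indep-aug M B I indB indI (≰⇒> ∣I∣≰∣B∣)
    ...   | e , _ , e∉B , indB+e =
      ⊥-elim (maxB (B ∪ ⁅ e ⁆) (p⊆p∪q ⁅ e ⁆ , e , q⊆p∪q B ⁅ e ⁆ (x∈⁅x⁆ e) , e∉B) indB+e)

    maximum⇒basis : ∀ {B} → Indep M B → (∀ I → Indep M I → ∣ I ∣ ≤ ∣ B ∣) → IsBasis M B
    maximum⇒basis indB maxB = indB , λ X B⊂X indX → <⇒≱ (p⊂q⇒∣p∣<∣q∣ B⊂X) (maxB X indX)

    bases-equicardinal : ∀ {B B′} → IsBasis M B → IsBasis M B′ → ∣ B ∣ ≡ ∣ B′ ∣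
    bases-equicardinal basisB basisB′ =
      ≤-antisym (basis-maximum basisB′ (proj₁ basisB)) (basis-maximum basisB (proj₁ basisB′))

    augment-to-size : ∀ k {J B} → Indep M J → Indep M B → k + ∣ J ∣ ≡ ∣ B ∣ →
                      Σ (Subset n) (λ J′ → J ⊆ J′ × Indep M J′ × ∣ J′ ∣ ≡ ∣ B ∣)
    augment-to-size zero    {J}     indJ _    k+∣J∣≡∣B∣ = J , (λ x∈J → x∈J) , indJ , k+∣J∣≡∣B∣
    augment-to-size (suc k) {J} {B} indJ indB k+∣J∣≡∣B∣
      with indep-aug M J B indJ indB (subst (∣ J ∣ <_) k+∣J∣≡∣B∣ (s≤s (m≤n+m ∣ J ∣ k)))
    ... | e , _ , e∉J , indJ+e
      with augment-to-size k indJ+e indB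
             (trans (cong (k +_) (x∉p⇒∣p∪⁅x⁆∣≡1+∣p∣ J e e∉J)) (trans (+-suc k ∣ J ∣) k+∣J∣≡∣B∣))
    ... | J′ , J+e⊆J′ , indJ′ , ∣J′∣≡∣B∣ = J′ , J+e⊆J′ ∘ p⊆p∪q ⁅ e ⁆ , indJ′ , ∣J′∣≡∣B∣

    indep⊆basis : ∀ {B J} → IsBasis M B → Indep M J → Σ (Subset n) (λ B′ → J ⊆ B′ × IsBasis M B′)
    indep⊆basis {B} {J} basisB indJ
      with augment-to-size (∣ B ∣ ∸ ∣ J ∣) indJ (proj₁ basisB) (m∸n+n≡m (basis-maximum basisB indJ))
    ... | B′ , J⊆B′ , indB′ , ∣B′∣≡∣B∣ =
      B′ , J⊆B′ , maximum⇒basis indB′ λ I indI →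
        subst (∣ I ∣ ≤_) (sym ∣B′∣≡∣B∣) (basis-maximum basisB indI)

    basis⇒rank : ∀ {B} → IsBasis M B → RankIs M ∣ B ∣
    basis⇒rank {B} basisB = (B , proj₁ basisB , refl) , λ I → basis-maximum basisB

    basis⇒corank : ∀ {B} → IsBasis M B → CoRankIs M (n ∸ ∣ B ∣)
    basis⇒corank {B} basisB = (∁ B , (B , basisB , (λ x∈∁B → x∈∁B)) , ∣∁p∣≡n∸∣p∣ B) , ∣coindep∣≤
      where
      ∣coindep∣≤ : ∀ J → CoIndep M J → ∣ J ∣ ≤ n ∸ ∣ B ∣
      ∣coindep∣≤ J (B′ , basisB′ , J⊆∁B′) = begin
        ∣ J ∣      ≤⟨ p⊆q⇒∣p∣≤∣q∣ J⊆∁B′ ⟩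
        ∣ ∁ B′ ∣   ≡⟨ ∣∁p∣≡n∸∣p∣ B′ ⟩
        n ∸ ∣ B′ ∣ ≡⟨ cong (n ∸_) (bases-equicardinal basisB′ basisB) ⟩
        n ∸ ∣ B ∣  ∎
        where open ≤-Reasoning

    coindep-↓ : Hereditary (CoIndep M)
    coindep-↓ I J J⊆I (B , basisB , I⊆∁B) = B , basisB , I⊆∁B ∘ J⊆I

  module _ {arm : Fin n → Fin m} where

    ∈armUnion⁺ : ∀ {S e} → arm e ∈ S → e ∈ armUnion arm S
    ∈armUnion⁺ {S} {e} arm-e∈S =
      lookup⇒[]= e (armUnion arm S) (trans (lookup∘tabulate (lookup S ∘ arm) e) ([]=⇒lookup arm-e∈S))

    ∈armUnion⁻ : ∀ {S e} → e ∈ armUnion arm S → arm e ∈ S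
    ∈armUnion⁻ {S} {e} e∈ =
      lookup⇒[]= (arm e) S (trans (sym (lookup∘tabulate (lookup S ∘ arm) e)) ([]=⇒lookup e∈))

    ∈armSet⇒arm≡ : ∀ {i e} → e ∈ armSet arm i → arm e ≡ i
    ∈armSet⇒arm≡ {i} = x∈⁅y⁆⇒x≡y i ∘ ∈armUnion⁻

    ∁armUnion⊆armUnion∁ : ∀ {S} → ∁ (armUnion arm S) ⊆ armUnion arm (∁ S)
    ∁armUnion⊆armUnion∁ {S} e∈∁ = ∈armUnion⁺ (x∉p⇒x∈∁p {p = S} (x∈∁p⇒x∉p e∈∁ ∘ ∈armUnion⁺))

    armUnion-nonempty : (∀ i → 1 ≤ ∣ armSet arm i ∣) → ∀ S → 1 ≤ ∣ S ∣ → Nonempty (armUnion arm S)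
    armUnion-nonempty arms≥1 S 1≤∣S∣ with 1≤∣p∣⇒Nonempty S 1≤∣S∣
    ... | i , i∈S with 1≤∣p∣⇒Nonempty (armSet arm i) (arms≥1 i)
    ...   | e , e∈Ai = e , ∈armUnion⁺ (subst (_∈ S) (sym (∈armSet⇒arm≡ e∈Ai)) i∈S)

  fullArms : (Fin n → Fin m) → Subset n → Subset m
  fullArms arm X = tabulate (λ i → does (armSet arm i ⊆? X))

  module _ {arm : Fin n → Fin m} {X : Subset n} where

    ∈fullArms⇒armSet⊆ : ∀ {i} → i ∈ fullArms arm X → armSet arm i ⊆ X
    ∈fullArms⇒armSet⊆ {i} i∈
      with armSet arm i ⊆? X | lookup∘tabulate (λ j → does (armSet arm j ⊆? X)) i
    ... | yes Ai⊆X | _ = Ai⊆X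
    ... | no  _    | ≡false with () ← trans (sym ≡false) ([]=⇒lookup i∈)

    ⊆fullArms⇒armUnion⊆ : ∀ {S} → S ⊆ fullArms arm X → armUnion arm S ⊆ X
    ⊆fullArms⇒armUnion⊆ S⊆F {e} e∈ =
      ∈fullArms⇒armSet⊆ (S⊆F (∈armUnion⁻ e∈)) (∈armUnion⁺ (x∈⁅x⁆ (arm e)))

    module _ (arms≤2 : ∀ i → ∣ armSet arm i ∣ ≤ 2) {K : Subset m} (X⊆ : X ⊆ armUnion arm K) where

      X∩armSet≡⊥ : ∀ {i} → lookup K i ≡ false → X ∩ armSet arm i ≡ ⊥
      X∩armSet≡⊥ {i} i∉K = Empty-unique λ (e , e∈) →
        let e∈X , e∈Ai = x∈p∩q⁻ X (armSet arm i) e∈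
            i∈K = subst (_∈ K) (∈armSet⇒arm≡ e∈Ai) (∈armUnion⁻ (X⊆ e∈X))
        in contradiction (trans (sym i∉K) ([]=⇒lookup i∈K)) λ ()

      ∣X∩armSet∣≤ : ∀ i → ∣ X ∩ armSet arm i ∣ ≤ 𝟙 (lookup K i) + 𝟙 (lookup (fullArms arm X) i)
      ∣X∩armSet∣≤ i rewrite lookup∘tabulate (λ j → does (armSet arm j ⊆? X)) i
        with lookup K i in K[i]≡false | armSet arm i ⊆? X
      ... | false | _ = ≤-trans (≤-reflexive (trans (cong ∣_∣ (X∩armSet≡⊥ K[i]≡false)) (∣⊥∣≡0 n))) z≤n
      ... | true  | yes _ = ≤-trans (∣p∩q∣≤∣q∣ X (armSet arm i)) (arms≤2 i)
      ... | true  | no Ai⊈X = ≤-pred (≤-trans ∣X∩Ai∣<∣Ai∣ (arms≤2 i))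
        where
        ∣X∩Ai∣<∣Ai∣ : ∣ X ∩ armSet arm i ∣ < ∣ armSet arm i ∣
        ∣X∩Ai∣<∣Ai∣ = p⊆q∧q⊈p⇒∣p∣<∣q∣ (p∩q⊆q X (armSet arm i))
                        (λ Ai⊆X∩Ai → Ai⊈X (p∩q⊆p X (armSet arm i) ∘ Ai⊆X∩Ai))

      ∣X∣≤∣K∣+∣fullArms∣ : ∣ X ∣ ≤ ∣ K ∣ + ∣ fullArms arm X ∣
      ∣X∣≤∣K∣+∣fullArms∣ = begin
        ∣ X ∣
          ≡⟨ ∑∣X∩armSet∣≡∣X∣ arm X ⟨
        ∑[ i < m ] ∣ X ∩ armSet arm i ∣
          ≤⟨ ∑-mono-≤ ∣X∩armSet∣≤ ⟩
        ∑[ i < m ] (𝟙 (lookup K i) + 𝟙 (lookup F i))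
          ≡⟨ ∑-distrib-+ (𝟙 ∘ lookup K) (𝟙 ∘ lookup F) ⟩
        ∑[ i < m ] 𝟙 (lookup K i) + ∑[ i < m ] 𝟙 (lookup F i)
          ≡⟨ cong₂ _+_ (∑-𝟙-lookup K) (∑-𝟙-lookup F) ⟩
        ∣ K ∣ + ∣ F ∣ ∎
        where
        F = fullArms arm X
        open ≤-Reasoning

  module _ {arm : Fin n → Fin m} (arms≤2 : ∀ i → ∣ armSet arm i ∣ ≤ 2)
           {s} {P : Subset n → Set} (P-↓ : Hereditary P)
           (no-s-arms : ∀ S → ∣ S ∣ ≡ s → ¬ P (armUnion arm S)) where

    ∣fullArms∣<s : ∀ {X} → P X → ∣ fullArms arm X ∣ < s
    ∣fullArms∣<s {X} PX with s ≤? ∣ fullArms arm X ∣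
    ... | no  s≰∣F∣ = ≰⇒> s≰∣F∣
    ... | yes s≤∣F∣ with ⊆-ofSize (fullArms arm X) s s≤∣F∣
    ...   | S , S⊆F , ∣S∣≡s =
      contradiction (P-↓ X (armUnion arm S) (⊆fullArms⇒armUnion⊆ S⊆F) PX) (no-s-arms S ∣S∣≡s)

    ∣X∣<∣K∣+s : ∀ {X K} → P X → X ⊆ armUnion arm K → ∣ X ∣ < ∣ K ∣ + s
    ∣X∣<∣K∣+s {X} {K} PX X⊆ =
      ≤-<-trans (∣X∣≤∣K∣+∣fullArms∣ {arm = arm} arms≤2 {K} X⊆) (+-monoʳ-< ∣ K ∣ (∣fullArms∣<s PX))

    P[Y-e]⇒∣Y∣≤m∸∣T∣+s : ∀ {Y e T} → P (Y - e) → Y - e ⊆ ∁ (armUnion arm T) →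
                         ∣ Y ∣ ≤ (m ∸ ∣ T ∣) + s
    P[Y-e]⇒∣Y∣≤m∸∣T∣+s {Y} {e} {T} PY-e Y-e⊆ = begin
      ∣ Y ∣             ≤⟨ ∣p∣≤1+∣p-x∣ Y e ⟩
      suc ∣ Y - e ∣     ≤⟨ ∣X∣<∣K∣+s {K = ∁ T} PY-e (∁armUnion⊆armUnion∁ {arm = arm} {T} ∘ Y-e⊆) ⟩
      ∣ ∁ T ∣ + s       ≡⟨ cong (_+ s) (∣∁p∣≡n∸∣p∣ T) ⟩
      (m ∸ ∣ T ∣) + s   ∎
      where open ≤-Reasoning

  +-tight : ∀ {x y a b} → x ≤ a → y ≤ b → x + y ≡ a + b → x ≡ a × y ≡ b
  +-tight {x} {y} {a} {b} x≤a y≤b x+y≡a+b =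
    x≡a , +-cancelˡ-≡ a y b (trans (cong (_+ y) (sym x≡a)) x+y≡a+b)
    where
    x≡a : x ≡ a
    x≡a = ≤-antisym x≤a (+-cancelʳ-≤ b a x (begin
      a + b ≡⟨ x+y≡a+b ⟨
      x + y ≤⟨ +-monoʳ-≤ x y≤b ⟩
      x + b ∎))
      where open ≤-Reasoning

  [m∸t+s]+[m∸s+t]≡m+m : ∀ {m s t} → s ≤ m → t ≤ m → (m ∸ t + s) + (m ∸ s + t) ≡ m + m
  [m∸t+s]+[m∸s+t]≡m+m {m} {s} {t} s≤m t≤m = begin
    (m ∸ t + s) + (m ∸ s + t) ≡⟨ interchange (m ∸ t) s (m ∸ s) t ⟩
    (m ∸ t + t) + (m ∸ s + s) ≡⟨ cong₂ _+_ (m∸n+n≡m t≤m) (m∸n+n≡m s≤m) ⟩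
    m + m                     ∎
    where
    open ≡-Reasoning
    interchange : ∀ a b c d → (a + b) + (c + d) ≡ (a + d) + (c + b)
    interchange = solve-∀

  +[m∸n]≡+m-+n : ∀ {m n} → n ≤ m → ℤ.+ (m ∸ n) ≡ ℤ.+ m ℤ.- ℤ.+ n
  +[m∸n]≡+m-+n {m} {n} n≤m = sym (trans (ℤ.m-n≡m⊖n m n) (ℤ.⊖-≥ n≤m))

  +[m∸n+k]≡+m-+n+k : ∀ {m n} k → n ≤ m → ℤ.+ (m ∸ n + k) ≡ (ℤ.+ m ℤ.- ℤ.+ n) ℤ.+ ℤ.+ k
  +[m∸n+k]≡+m-+n+k {m} {n} k n≤m =
    trans (ℤ.pos-+ (m ∸ n) k) (cong (ℤ._+ ℤ.+ k) (+[m∸n]≡+m-+n n≤m))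

  +[m∸n+k]≡+m+k-+n : ∀ {m n} k → n ≤ m → ℤ.+ (m ∸ n + k) ≡ (ℤ.+ m ℤ.+ ℤ.+ k) ℤ.- ℤ.+ n
  +[m∸n+k]≡+m+k-+n {m} {n} k n≤m =
    trans (+[m∸n+k]≡+m-+n+k k n≤m) (a-b+c≡a+c-b (ℤ.+ m) (ℤ.+ n) (ℤ.+ k))
    where
    a-b+c≡a+c-b : ∀ a b c → (a ℤ.- b) ℤ.+ c ≡ (a ℤ.+ c) ℤ.- b
    a-b+c≡a+c-b = solve-∀-ℤ

  module _ {s t m n} {M : Matroid n} {arm : Fin n → Fin m} (spike : IsSpike M s t m arm) where
    open IsSpike spike

    private
      arms≤2 : ∀ i → ∣ armSet arm i ∣ ≤ 2
      arms≤2 = ≤-reflexive ∘ arms-size2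

      arms≥1 : ∀ i → 1 ≤ ∣ armSet arm i ∣
      arms≥1 i = subst (1 ≤_) (sym (arms-size2 i)) (s≤s z≤n)

      arms-ofSize : ∀ {k} → k ≤ m → Σ (Subset m) (λ S → ∣ S ∣ ≡ k)
      arms-ofSize {k} k≤m with ⊆-ofSize ⊤ k (subst (k ≤_) (sym (∣⊤∣≡n m)) k≤m)
      ... | S , _ , ∣S∣≡k = S , ∣S∣≡k

    n≡m+m : n ≡ m + m
    n≡m+m = begin
      n                                ≡⟨ ∣⊤∣≡n n ⟨
      ∣ ⊤ {n} ∣                        ≡⟨ ∑∣X∩armSet∣≡∣X∣ arm ⊤ ⟨
      ∑[ i < m ] ∣ ⊤ ∩ armSet arm i ∣ ≡⟨ sum-cong-≗ ∣⊤∩armSet∣≡2 ⟩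
      ∑[ i < m ] 2                     ≡⟨ ∑-const m 2 ⟩
      m * 2                            ≡⟨ *-comm m 2 ⟩
      m + (m + 0)                      ≡⟨ cong (m +_) (+-identityʳ m) ⟩
      m + m                            ∎
      where
      open ≡-Reasoning
      ∣⊤∩armSet∣≡2 : ∀ i → ∣ ⊤ ∩ armSet arm i ∣ ≡ 2
      ∣⊤∩armSet∣≡2 i = trans (cong ∣_∣ (∩-identityˡ (armSet arm i))) (arms-size2 i)

    basis-bound : 1 ≤ t → Σ (Subset n) (λ B → IsBasis M B × ∣ B ∣ ≤ (m ∸ t) + s)
    basis-bound 1≤t with arms-ofSize t≤m
    ... | T , ∣T∣≡t with armUnion-nonempty arms≥1 T (subst (1 ≤_) (sym ∣T∣≡t) 1≤t)
    ...   | e , e∈D with proj₂ (t-cocircuit T ∣T∣≡t) (armUnion arm T - e) (x∈p⇒p-x⊂p e∈D)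
    ...     | B , basisB , D-e⊆∁B = B , basisB , subst (λ k → ∣ B ∣ ≤ (m ∸ k) + s) ∣T∣≡t
      (P[Y-e]⇒∣Y∣≤m∸∣T∣+s arms≤2 (indep-↓ M) (λ S ∣S∣≡s → proj₁ (s-circuit S ∣S∣≡s)) {T = T}
        (indep-↓ M B (B - e) (p─q⊆p B ⁅ e ⁆) (proj₁ basisB)) (p─r⊆∁q⇒q─r⊆∁p D-e⊆∁B))

    corank-bound : 1 ≤ s → ∀ {B} → IsBasis M B → n ∸ ∣ B ∣ ≤ (m ∸ s) + t
    corank-bound 1≤s {B} basisB with arms-ofSize s≤m
    ... | S , ∣S∣≡s with armUnion-nonempty arms≥1 S (subst (1 ≤_) (sym ∣S∣≡s) 1≤s)
    ...   | e , e∈C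
      with indep⊆basis M basisB (proj₂ (s-circuit S ∣S∣≡s) (armUnion arm S - e) (x∈p⇒p-x⊂p e∈C))
    ...     | B′ , C-e⊆B′ , basisB′ = begin
      n ∸ ∣ B ∣       ≡⟨ cong (n ∸_) (bases-equicardinal M basisB basisB′) ⟩
      n ∸ ∣ B′ ∣      ≡⟨ ∣∁p∣≡n∸∣p∣ B′ ⟨
      ∣ ∁ B′ ∣        ≤⟨ P[Y-e]⇒∣Y∣≤m∸∣T∣+s arms≤2 (coindep-↓ M)
                           (λ T ∣T∣≡t → proj₁ (t-cocircuit T ∣T∣≡t)) {T = S}
                           (B′ , basisB′ , p─q⊆p (∁ B′) ⁅ e ⁆)
                           (p─r⊆∁q⇒q─r⊆∁p (x∉p⇒x∈∁p ∘ x∈p⇒x∉∁p ∘ C-e⊆B′)) ⟩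
      (m ∸ ∣ S ∣) + t ≡⟨ cong (λ k → (m ∸ k) + t) ∣S∣≡s ⟩
      (m ∸ s) + t     ∎
      where open ≤-Reasoning

    spike-basis-sizes : 1 ≤ s → 1 ≤ t →
      Σ (Subset n) (λ B → IsBasis M B × ∣ B ∣ ≡ (m ∸ t) + s × n ∸ ∣ B ∣ ≡ (m ∸ s) + t)
    spike-basis-sizes 1≤s 1≤t =
      let B , basisB , ∣B∣≤ = basis-bound 1≤t
      in  B , basisB , +-tight ∣B∣≤ (corank-bound 1≤s basisB) (sizes-sum B)
      where
      sizes-sum : ∀ B → ∣ B ∣ + (n ∸ ∣ B ∣) ≡ (m ∸ t + s) + (m ∸ s + t)
      sizes-sum B = begin
        ∣ B ∣ + (n ∸ ∣ B ∣)       ≡⟨ m+[n∸m]≡n (∣p∣≤n B) ⟩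
        n                         ≡⟨ n≡m+m ⟩
        m + m                     ≡⟨ [m∸t+s]+[m∸s+t]≡m+m s≤m t≤m ⟨
        (m ∸ t + s) + (m ∸ s + t) ∎
        where open ≡-Reasoning

open SpikeRank
  using (spike-basis-sizes; basis⇒rank; basis⇒corank; +[m∸n+k]≡+m+k-+n; +[m∸n+k]≡+m-+n+k)
open import Data.Integer using (+_; _+_; _-_)

lemma5p2 : (s t m n : ℕ) → 1 ≤ s → 1 ≤ t →
    (M : Matroid n) → (arm : Fin n → Fin m) → IsSpike M s t m arm →
    Σ ℕ (λ r → RankIs M r × + r ≡ (+ m + + s) - + t) ×
    Σ ℕ (λ r* → CoRankIs M r* × + r* ≡ (+ m - + s) + + t)
lemma5p2 s t m n 1≤s 1≤t M arm spike =
  let B , basisB , ∣B∣≡m∸t+s , n∸∣B∣≡m∸s+t = spike-basis-sizes spike 1≤s 1≤t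
  in  (∣ B ∣ , basis⇒rank M basisB ,
       trans (cong +_ ∣B∣≡m∸t+s) (+[m∸n+k]≡+m+k-+n s (IsSpike.t≤m spike))) ,
      (n ∸ ∣ B ∣ , basis⇒corank M basisB ,
       trans (cong +_ n∸∣B∣≡m∸s+t) (+[m∸n+k]≡+m-+n+k t (IsSpike.s≤m spike)))
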